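{- Let $k,a,n$ be integers with $k\ge 1$ and $n\ge a\ge 0$. If $a<\partial^{k+1}(n)$, then $\partial^{k}(a)+\partial^{k+1}(n-a)\ge \partial^{k+1}(n)$. Moreover, if $n=\binom{N}{k+1}$ for some $N\ge k+1$, then equality in $\partial^{k}(a)+\partial^{k+1}(n-a)\ge \partial^{k+1}(n)$ holds only when $a=0$.
   Context: Given integers $k\ge 1$ and $n\ge 0$, write $n$ uniquely as $n=\binom{n_k}{k}+\binom{n_{k-1}}{k-1}+\dots+\binom{n_1}{1}$ with $0\le n_1<n_2<\dots<n_k$ (the $k$-binomial representation of $n$). The Kruskal-Macaulay function is $\partial^{k}(n)=\binom{n_k-1}{k-1}+\binom{n_{k-1}-1}{k-2}+\dots+\binom{n_1-1}{0}$. -}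

module Defs where

open import Data.Nat using (ℕ; zero; suc; _+_; _∸_; _≤ᵇ_)
open import Data.Bool using (if_then_else_)
open import Data.Nat.Combinatorics using (_C_)

searchTop : ℕ → ℕ → ℕ → ℕ
searchTop i n zero    = zero
searchTop i n (suc b) = if (suc b C i) ≤ᵇ n then suc b else searchTop i n b

-- n_i in the i-binomial representation of n: the largest m with (m C i) ≤ n
-- (greedy choice; for i ≥ 1 such m is < n + i, so searching below n + i suffices).
repTop : ℕ → ℕ → ℕ
repTop i n = searchTop i n (n + i)

-- The term binom(m - 1, j) with the convention binom(-1, j) = 0.
predBinom : ℕ → ℕ → ℕ
predBinom zero    j = zero
predBinom (suc m) j = m C j

-- Kruskal–Macaulay function ∂^k(n):
-- n = C(n_k,k) + ... + C(n_1,1) (greedy/unique representation),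
-- ∂^k(n) = C(n_k - 1, k - 1) + ... + C(n_1 - 1, 0).
∂ : ℕ → ℕ → ℕ
∂ zero    n = zero
∂ (suc k) n = predBinom (repTop (suc k) n) k + ∂ k (n ∸ (repTop (suc k) n C suc k))

-- Every n has a top decomposition n = binom N (k+1) + m with
--    m < binom N k, the greedy search of Defs finds it, and so
--    ∂ (k+1) n = binom (N-1) k + ∂ k m.  From this: ∂ i 0 = 0, the shadow of a
--    complete level, ∂ ≤ id, and monotonicity of ∂.
-- 2. Complement duality: if x + y = binom (j+J) j then
--    ∂ j x + y = binom (j+J-1) J + ∂ J y.
-- 3. One simultaneous induction on a size bound and the level proves that ∂ i is
--    subadditive, that ∂ i ≤ ∂ (i+1), an "exchange" inequality at complete
--    levels, and the inequality of the theorem (ShadowInequality).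
-- 4. Equality case: near a complete level n = binom (M+1) (k+1) removing up to
--    M - k elements keeps the shadow, ∂ is strictly increasing in suitable ranges
--    (via duality and ∂ j y < y), and combining with the inequality of step 3
--    makes the inequality strict for a ≥ 1.
module Submission where

open import Defs
open import Data.Nat using (ℕ; zero; suc; _+_; _∸_; _≤_; _<_; _≥_; z≤n; s≤s; z<s; _≤ᵇ_; _≤?_)
open import Data.Nat.Properties
open import Data.Nat.Combinatorics using (_C_; nCk+nC[k+1]≡[n+1]C[k+1]; k>n⇒nCk≡0; nCk≡nC[n∸k])
open import Data.Bool using (T; true; false)
open import Data.Unit using (tt)
open import Data.Product using (_×_; _,_)
open import Data.Sum using (inj₁; inj₂)
open import Data.Empty using (⊥-elim)
open import Relation.Nullary using (yes; no)
open import Relation.Binary.PropositionalEquality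
  using (_≡_; refl; sym; trans; cong; cong₂; subst; subst₂; module ≡-Reasoning)
open import Data.Nat.Tactic.RingSolver using (solve-∀)

+-exchange : ∀ a b c → a + (b + c) ≡ b + (a + c)
+-exchange = solve-∀

+-right-comm : ∀ a b c → (a + b) + c ≡ (a + c) + b
+-right-comm = solve-∀

+-interchange : ∀ a b c d → (a + b) + (c + d) ≡ (a + c) + (b + d)
+-interchange = solve-∀

-- Binomial coefficients by Pascal's rule; unlike _C_ this form computes by
-- pattern matching, and binom≡C transfers every result back to _C_.
binom : ℕ → ℕ → ℕ
binom n       zero    = 1
binom zero    (suc k) = 0
binom (suc n) (suc k) = binom n k + binom n (suc k)

binom≡C : ∀ n k → binom n k ≡ n C k
binom≡C n       zero    = refl
binom≡C zero    (suc k) = sym (k>n⇒nCk≡0 {n = 0} {k = suc k} z<s)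
binom≡C (suc n) (suc k) =
  trans (cong₂ _+_ (binom≡C n k) (binom≡C n (suc k))) (nCk+nC[k+1]≡[n+1]C[k+1] n k)

predBinom-suc : ∀ M k → predBinom (suc M) k ≡ binom M k
predBinom-suc M k = sym (binom≡C M k)

binom-zero : ∀ n k → n < k → binom n k ≡ 0
binom-zero zero    (suc k) _         = refl
binom-zero (suc n) (suc k) (s≤s n<k) =
  cong₂ _+_ (binom-zero n k n<k) (binom-zero n (suc k) (m<n⇒m<1+n n<k))

binom-diag : ∀ n → binom n n ≡ 1
binom-diag zero    = refl
binom-diag (suc n) = cong₂ _+_ (binom-diag n) (binom-zero n (suc n) (n<1+n n))

binom-pos : ∀ n k → k ≤ n → 1 ≤ binom n k
binom-pos n       zero    _         = s≤s z≤n
binom-pos (suc n) (suc k) (s≤s k≤n) = ≤-trans (binom-pos n k k≤n) (m≤m+n _ _)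

binom-pos⇒≤ : ∀ n k → 1 ≤ binom n k → k ≤ n
binom-pos⇒≤ n k pos with k ≤? n
... | yes k≤n = k≤n
... | no  k≰n = ⊥-elim (<⇒≱ pos (≤-reflexive (binom-zero n k (≰⇒> k≰n))))

binom-one : ∀ n → binom n 1 ≡ n
binom-one zero    = refl
binom-one (suc n) = cong suc (binom-one n)

binom-suc-≤ : ∀ n k → binom n k ≤ binom (suc n) k
binom-suc-≤ n zero    = ≤-refl
binom-suc-≤ n (suc k) = m≤n+m _ _

binom-mono : ∀ {a b} k → a ≤ b → binom a k ≤ binom b k
binom-mono {a} k a≤b with m≤n⇒∃[o]m+o≡n a≤b
... | o , refl = go o
  where
  go : ∀ o → binom a k ≤ binom (a + o) k
  go zero    = ≤-reflexive (cong (λ t → binom t k) (sym (+-identityʳ a)))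
  go (suc o) = subst (λ t → binom a k ≤ binom t k) (sym (+-suc a o))
                     (≤-trans (go o) (binom-suc-≤ (a + o) k))

binom-sym : ∀ a b → binom (a + b) a ≡ binom (a + b) b
binom-sym a b = begin
  binom (a + b) a        ≡⟨ binom≡C (a + b) a ⟩
  (a + b) C a            ≡⟨ nCk≡nC[n∸k] (m≤m+n a b) ⟩
  (a + b) C (a + b ∸ a)  ≡⟨ cong ((a + b) C_) (m+n∸m≡n a b) ⟩
  (a + b) C b            ≡⟨ sym (binom≡C (a + b) b) ⟩
  binom (a + b) b        ∎
  where open ≡-Reasoning

binom-sym-suc : ∀ j J → binom (suc (j + J)) j ≡ binom (suc (j + J)) (suc J)
binom-sym-suc j J = subst (λ t → binom t j ≡ binom t (suc J)) (+-suc j J) (binom-sym j (suc J))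

-- binom N (k+1) grows fast enough that N < binom N (k+1) + (k+1); this bounds
-- the range searched by repTop.
binom-index-bound : ∀ N k → N ≤ binom N (suc k) + suc k
binom-index-bound zero    k = z≤n
binom-index-bound (suc N) k with N ≤? k
... | yes N≤k = ≤-trans (s≤s N≤k) (m≤n+m (suc k) _)
... | no  N≰k = begin
  suc N                              ≤⟨ s≤s (binom-index-bound N k) ⟩
  1 + binom N (suc k) + suc k        ≤⟨ +-monoˡ-≤ (suc k) (+-monoˡ-≤ (binom N (suc k))
                                          (binom-pos N k (<⇒≤ (≰⇒> N≰k)))) ⟩
  binom (suc N) (suc k) + suc k      ∎
  where open ≤-Reasoning

searchTop-finds : ∀ i n N b → N ≤ b → binom N i ≤ n → n < binom (suc N) i →
                  searchTop i n b ≡ N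
searchTop-finds i n N zero    z≤n _ _ = refl
searchTop-finds i n N (suc b) N≤b+1 lo hi with (suc b C i) ≤ᵇ n in test
... | true  = ≤-antisym (≮⇒≥ λ N<b+1 → <⇒≱ hi (≤-trans (binom-mono i N<b+1) top≤n)) N≤b+1
  where
  top≤n : binom (suc b) i ≤ n
  top≤n = subst (_≤ n) (sym (binom≡C (suc b) i)) (≤ᵇ⇒≤ _ _ (subst T (sym test) tt))
... | false with m≤n⇒m<n∨m≡n N≤b+1
...   | inj₁ N<b+1 = searchTop-finds i n N b (≤-pred N<b+1) lo hi
...   | inj₂ refl  = ⊥-elim (subst T test (≤⇒≤ᵇ (subst (_≤ n) (binom≡C (suc b) i) lo)))

-- The cascade step: if m < binom N k then the top term of the (k+1)-binomial
-- representation of binom N (k+1) + m is binom N (k+1), so ∂ peels it off.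
∂-cascade : ∀ k N m → m < binom N k →
            ∂ (suc k) (binom N (suc k) + m) ≡ predBinom N k + ∂ k m
∂-cascade k N m m<B = begin
  predBinom (repTop (suc k) n) k + ∂ k (n ∸ (repTop (suc k) n C suc k))
    ≡⟨ cong (λ t → predBinom t k + ∂ k (n ∸ (t C suc k))) top≡N ⟩
  predBinom N k + ∂ k (n ∸ (N C suc k))
    ≡⟨ cong (λ t → predBinom N k + ∂ k (n ∸ t)) (sym (binom≡C N (suc k))) ⟩
  predBinom N k + ∂ k (n ∸ binom N (suc k))
    ≡⟨ cong (λ t → predBinom N k + ∂ k t) (m+n∸m≡n (binom N (suc k)) m) ⟩
  predBinom N k + ∂ k m ∎
  where
  open ≡-Reasoning
  n = binom N (suc k) + m
  top≡N : repTop (suc k) n ≡ N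
  top≡N = searchTop-finds (suc k) n N (n + suc k)
    (≤-trans (binom-index-bound N k) (+-monoˡ-≤ (suc k) (m≤m+n _ m)))
    (m≤m+n _ m)
    (subst (n <_) (+-comm (binom N (suc k)) (binom N k)) (+-monoʳ-< (binom N (suc k)) m<B))

record TopDecomposition (k n : ℕ) : Set where
  constructor top
  field
    N m   : ℕ
    k≤N   : k ≤ N
    m<B   : m < binom N k
    split : n ≡ binom N (suc k) + m

-- Built by counting up: the remainder grows until it reaches binom N k,
-- at which point binom N (k+1) + binom N k = binom (N+1) (k+1).
topDecomposition : ∀ k n → TopDecomposition k n
topDecomposition k zero =
  top k 0 ≤-refl (subst (0 <_) (sym (binom-diag k)) z<s)
      (sym (trans (+-identityʳ _) (binom-zero k (suc k) (n<1+n k))))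
topDecomposition k (suc n) with topDecomposition k n
... | top N m k≤N m<B refl with m≤n⇒m<n∨m≡n m<B
...   | inj₁ m+1<B = top N (suc m) k≤N m+1<B (sym (+-suc (binom N (suc k)) m))
...   | inj₂ m+1≡B = top (suc N) 0 (m≤n⇒m≤1+n k≤N) (binom-pos (suc N) k (m≤n⇒m≤1+n k≤N)) (begin
  suc (binom N (suc k) + m)          ≡⟨ sym (+-suc (binom N (suc k)) m) ⟩
  binom N (suc k) + suc m            ≡⟨ cong (binom N (suc k) +_) m+1≡B ⟩
  binom N (suc k) + binom N k        ≡⟨ +-comm (binom N (suc k)) (binom N k) ⟩
  binom (suc N) (suc k)              ≡⟨ sym (+-identityʳ _) ⟩
  binom (suc N) (suc k) + 0          ∎)
  where open ≡-Reasoning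

predBinom-diag : ∀ k → predBinom k k ≡ 0
predBinom-diag zero    = refl
predBinom-diag (suc k) = trans (predBinom-suc k (suc k)) (binom-zero k (suc k) (n<1+n k))

predBinom-pascal : ∀ N k → predBinom N k + predBinom N (suc k) ≡ predBinom (suc N) (suc k)
predBinom-pascal zero    k = refl
predBinom-pascal (suc M) k = trans (cong₂ _+_ (predBinom-suc M k) (predBinom-suc M (suc k)))
                                   (sym (predBinom-suc (suc M) (suc k)))

∂-zero : ∀ i → ∂ i 0 ≡ 0
∂-zero zero    = refl
∂-zero (suc k) = begin
  ∂ (suc k) 0                         ≡⟨ cong (∂ (suc k)) (sym top≡0) ⟩
  ∂ (suc k) (binom k (suc k) + 0)     ≡⟨ ∂-cascade k k 0 (subst (0 <_) (sym (binom-diag k)) z<s) ⟩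
  predBinom k k + ∂ k 0               ≡⟨ cong₂ _+_ (predBinom-diag k) (∂-zero k) ⟩
  0                                   ∎
  where
  open ≡-Reasoning
  top≡0 : binom k (suc k) + 0 ≡ 0
  top≡0 = trans (+-identityʳ _) (binom-zero k (suc k) (n<1+n k))

∂-binom : ∀ M k → ∂ (suc k) (binom (suc M) (suc k)) ≡ binom M k
∂-binom M k with k ≤? suc M
... | yes k≤M+1 = begin
  ∂ (suc k) (binom (suc M) (suc k))      ≡⟨ cong (∂ (suc k)) (sym (+-identityʳ (binom (suc M) (suc k)))) ⟩
  ∂ (suc k) (binom (suc M) (suc k) + 0)  ≡⟨ ∂-cascade k (suc M) 0 (binom-pos (suc M) k k≤M+1) ⟩
  predBinom (suc M) k + ∂ k 0            ≡⟨ cong₂ _+_ (predBinom-suc M k) (∂-zero k) ⟩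
  binom M k + 0                          ≡⟨ +-identityʳ _ ⟩
  binom M k                              ∎
  where open ≡-Reasoning
... | no k≰M+1 = begin
  ∂ (suc k) (binom (suc M) (suc k))      ≡⟨ cong (∂ (suc k)) (binom-zero (suc M) (suc k) (m<n⇒m<1+n (≰⇒> k≰M+1))) ⟩
  ∂ (suc k) 0                            ≡⟨ ∂-zero (suc k) ⟩
  0                                      ≡⟨ sym (binom-zero M k (<-trans (n<1+n M) (≰⇒> k≰M+1))) ⟩
  binom M k                              ∎
  where open ≡-Reasoning

∂-binom′ : ∀ N k → ∂ (suc k) (binom N (suc k)) ≡ predBinom N k
∂-binom′ zero    k = ∂-zero (suc k)
∂-binom′ (suc M) k = trans (∂-binom M k) (sym (predBinom-suc M k))

-- Pascal's rule read as "a complete level splits into its lower part and its shadow":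
-- binom M (k+1) = binom (M-1) (k+1) + ∂ (k+1) (binom M (k+1)).
binom-split : ∀ M k → binom M (suc k) ≡ predBinom M (suc k) + ∂ (suc k) (binom M (suc k))
binom-split zero    k = sym (∂-zero (suc k))
binom-split (suc M) k = trans (+-comm (binom M k) (binom M (suc k)))
                              (sym (cong₂ _+_ (predBinom-suc M (suc k)) (∂-binom M k)))

-- The shadow is never larger than the family: each cascade term shrinks.
∂≤id : ∀ i x → ∂ i x ≤ x
∂≤id zero    x = z≤n
∂≤id (suc k) x with topDecomposition k x
... | top N m _ m<B refl = subst (_≤ binom N (suc k) + m) (sym (∂-cascade k N m m<B))
                                 (+-mono-≤ (predBinom≤binom N) (∂≤id k m))
  where
  predBinom≤binom : ∀ N → predBinom N k ≤ binom N (suc k)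
  predBinom≤binom zero    = z≤n
  predBinom≤binom (suc M) = subst (_≤ binom (suc M) (suc k)) (sym (predBinom-suc M k)) (m≤m+n _ _)

mutual
  -- Monotonicity of ∂ i, one step at a time.  Inside one top decomposition this
  -- is the induction hypothesis; across a complete level it is ∂-below-binom.
  ∂-mono-suc : ∀ i x → ∂ i x ≤ ∂ i (suc x)
  ∂-mono-suc zero    x = z≤n
  ∂-mono-suc (suc k) x with topDecomposition k (suc x)
  ... | top N (suc m) _ m+1<B split = begin
    ∂ (suc k) x                          ≡⟨ cong (∂ (suc k)) x≡ ⟩
    ∂ (suc k) (binom N (suc k) + m)      ≡⟨ ∂-cascade k N m (<⇒≤ m+1<B) ⟩
    predBinom N k + ∂ k m                ≤⟨ +-monoʳ-≤ (predBinom N k) (∂-mono-suc k m) ⟩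
    predBinom N k + ∂ k (suc m)          ≡⟨ sym (∂-cascade k N (suc m) m+1<B) ⟩
    ∂ (suc k) (binom N (suc k) + suc m)  ≡⟨ cong (∂ (suc k)) (sym split) ⟩
    ∂ (suc k) (suc x)                    ∎
    where
    open ≤-Reasoning
    x≡ : x ≡ binom N (suc k) + m
    x≡ = suc-injective (trans split (+-suc (binom N (suc k)) m))
  ... | top zero zero _ _ split = ⊥-elim (0≢1+n (sym split))
  ... | top (suc M) zero _ _ split = begin
    ∂ (suc k) x                          ≤⟨ ∂-below-binom k M x (trans split (+-identityʳ _)) ⟩
    binom M k                            ≡⟨ sym (∂-binom M k) ⟩
    ∂ (suc k) (binom (suc M) (suc k))    ≡⟨ cong (∂ (suc k)) (sym (trans split (+-identityʳ _))) ⟩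
    ∂ (suc k) (suc x)                    ∎
    where open ≤-Reasoning

  ∂-below-binom : ∀ k M x → suc x ≡ binom (suc M) (suc k) → ∂ (suc k) x ≤ binom M k
  ∂-below-binom k M x x+1≡ with k ≤? M
  ... | no k≰M = ⊥-elim (0≢1+n (sym (trans x+1≡
          (cong₂ _+_ (binom-zero M k (≰⇒> k≰M)) (binom-zero M (suc k) (m<n⇒m<1+n (≰⇒> k≰M)))))))
  ... | yes k≤M = begin
    ∂ (suc k) x                          ≡⟨ cong (∂ (suc k)) x≡ ⟩
    ∂ (suc k) (binom M (suc k) + p)      ≡⟨ ∂-cascade k M p p<B ⟩
    predBinom M k + ∂ k p                ≤⟨ cascade-bound k M p k≤M p<B ⟩
    binom M k                            ∎
    where
    open ≤-Reasoning
    p = binom M k ∸ 1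
    p+1≡B : suc p ≡ binom M k
    p+1≡B = trans (+-comm 1 p) (m∸n+n≡m (binom-pos M k k≤M))
    p<B : p < binom M k
    p<B = subst (p <_) p+1≡B (n<1+n p)
    x≡ : x ≡ binom M (suc k) + p
    x≡ = suc-injective (begin-equality
      suc x                              ≡⟨ x+1≡ ⟩
      binom M k + binom M (suc k)        ≡⟨ cong (_+ binom M (suc k)) (sym p+1≡B) ⟩
      suc (p + binom M (suc k))          ≡⟨ cong suc (+-comm p (binom M (suc k))) ⟩
      suc (binom M (suc k) + p)          ∎)

  cascade-bound : ∀ k M p → k ≤ M → p < binom M k → predBinom M k + ∂ k p ≤ binom M k
  cascade-bound zero    zero    p _  _ = z≤n
  cascade-bound zero    (suc M) p _  _ = ≤-refl
  cascade-bound (suc k) (suc M) p _ p<B = begin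
    predBinom (suc M) (suc k) + ∂ (suc k) p
      ≤⟨ +-mono-≤ (≤-reflexive (predBinom-suc M (suc k))) (∂-mono (suc k) (<⇒≤ p<B)) ⟩
    binom M (suc k) + ∂ (suc k) (binom (suc M) (suc k))
      ≡⟨ cong (binom M (suc k) +_) (∂-binom M k) ⟩
    binom M (suc k) + binom M k
      ≡⟨ +-comm (binom M (suc k)) (binom M k) ⟩
    binom (suc M) (suc k) ∎
    where open ≤-Reasoning

  ∂-mono : ∀ i {x y} → x ≤ y → ∂ i x ≤ ∂ i y
  ∂-mono i {x} x≤y with m≤n⇒∃[o]m+o≡n x≤y
  ... | o , refl = go o
    where
    go : ∀ o → ∂ i x ≤ ∂ i (x + o)
    go zero    = ≤-reflexive (cong (∂ i) (sym (+-identityʳ x)))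
    go (suc o) = subst (λ t → ∂ i x ≤ ∂ i t) (sym (+-suc x o))
                       (≤-trans (go o) (∂-mono-suc i (x + o)))

∂-one : ∀ j → ∂ (suc j) 1 ≡ 1
∂-one j = begin
  ∂ (suc j) 1                            ≡⟨ cong (∂ (suc j)) (sym (binom-diag (suc j))) ⟩
  ∂ (suc j) (binom (suc j) (suc j))      ≡⟨ ∂-binom j j ⟩
  binom j j                              ≡⟨ binom-diag j ⟩
  1                                      ∎
  where open ≡-Reasoning

∂-pos : ∀ j a → 1 ≤ ∂ (suc j) (suc a)
∂-pos j a = subst (_≤ ∂ (suc j) (suc a)) (∂-one j) (∂-mono (suc j) (s≤s z≤n))

∂₁≤1 : ∀ x → ∂ 1 x ≤ 1
∂₁≤1 x with topDecomposition 0 x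
... | top N zero _ m<B refl = subst (_≤ 1) (sym (∂-cascade 0 N 0 m<B)) (predBinom≤1 N)
  where
  predBinom≤1 : ∀ N → predBinom N 0 + 0 ≤ 1
  predBinom≤1 zero    = z≤n
  predBinom≤1 (suc M) = ≤-refl
... | top N (suc m) _ (s≤s ()) _

∂₁-suc : ∀ x → ∂ 1 (suc x) ≡ 1
∂₁-suc x = ≤-antisym (∂₁≤1 (suc x)) (∂-pos 0 x)

sum≡1-elim : (P : ℕ → ℕ → Set) → P 0 1 → P 1 0 → ∀ x y → x + y ≡ 1 → P x y
sum≡1-elim P p01 p10 zero          1             refl = p01
sum≡1-elim P p01 p10 1             zero          refl = p10
sum≡1-elim P _   _   zero          (suc (suc _)) ()
sum≡1-elim P _   _   (suc (suc _)) zero          ()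
sum≡1-elim P _   _   (suc a)       (suc b)       e =
  ⊥-elim (0≢1+n (sym (trans (sym (+-suc a b)) (suc-injective e))))

-- If x + y = binom (j + J) j, think of x as an initial
-- segment of the j-subsets of an (j+J)-set and y as the rest; complementing
-- turns the rest into an initial segment of J-subsets, and the shadows match up:
--   ∂ j x + y = binom (j + J - 1) J + ∂ J y.
-- The proof follows Pascal's rule binom (L+2) (j+1) = P + P' with
-- P = binom (L+1) (j+1) and P' = binom (L+1) (J+1) (where L = j + J),
-- according to whether the top block P lies inside x or P' inside y.
mutual
  ∂-complement : ∀ j J x y → 1 ≤ j + J → x + y ≡ binom (j + J) j →
                 ∂ j x + y ≡ predBinom (j + J) J + ∂ J y
  ∂-complement zero (suc J) x y _ x+y≡1 =
    sum≡1-elim (λ x y → ∂ 0 x + y ≡ predBinom (suc J) (suc J) + ∂ (suc J) y)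
      (sym (cong₂ _+_ (predBinom-diag (suc J)) (∂-one J)))
      (sym (cong₂ _+_ (predBinom-diag (suc J)) (∂-zero (suc J))))
      x y x+y≡1
  ∂-complement (suc j) zero x y _ x+y≡ =
    sum≡1-elim (λ x y → ∂ (suc j) x + y ≡ 1)
      (cong (_+ 1) (∂-zero (suc j)))
      (trans (+-identityʳ _) (∂-one j))
      x y (trans x+y≡ (trans (cong (λ t → binom t (suc j)) (+-identityʳ (suc j))) (binom-diag (suc j))))
  ∂-complement (suc j) (suc J) x y _ x+y≡ = begin
    ∂ (suc j) x + y                                   ≡⟨ complement-step j J x y x+y≡′ ⟩
    binom (suc (j + J)) (suc J) + ∂ (suc J) y         ≡⟨ cong (_+ ∂ (suc J) y) (sym predBinom≡) ⟩
    predBinom (suc j + suc J) (suc J) + ∂ (suc J) y   ∎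
    where
    open ≡-Reasoning
    x+y≡′ : x + y ≡ binom (suc (suc (j + J))) (suc j)
    x+y≡′ = trans x+y≡ (cong (λ t → binom (suc t) (suc j)) (+-suc j J))
    predBinom≡ : predBinom (suc j + suc J) (suc J) ≡ binom (suc (j + J)) (suc J)
    predBinom≡ = trans (cong (λ t → predBinom (suc t) (suc J)) (+-suc j J)) (predBinom-suc _ (suc J))

  complement-step : ∀ j J x y → x + y ≡ binom (suc (suc (j + J))) (suc j) →
                    ∂ (suc j) x + y ≡ binom (suc (j + J)) (suc J) + ∂ (suc J) y
  complement-step j J x y x+y≡ with binom (suc (j + J)) (suc j) ≤? x
  ... | yes P≤x with m≤n⇒∃[o]m+o≡n P≤x
  ...   | x' , refl = complement-top-in-x j J x' y (+-cancelˡ-≡ P (x' + y) _ (begin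
    P + (x' + y)                                     ≡⟨ sym (+-assoc P x' y) ⟩
    P + x' + y                                       ≡⟨ x+y≡ ⟩
    binom (suc (j + J)) j + P                        ≡⟨ +-comm (binom (suc (j + J)) j) P ⟩
    P + binom (suc (j + J)) j                        ∎))
    where
    open ≡-Reasoning
    P = binom (suc (j + J)) (suc j)
  complement-step j J x y x+y≡ | no P≰x =
    subst (λ t → ∂ (suc j) x + t ≡ P′ + ∂ (suc J) t) (sym y≡)
          (complement-top-in-y j J x (P ∸ x) (m+[n∸m]≡n (<⇒≤ x<P)))
    where
    P  = binom (suc (j + J)) (suc j)
    P′ = binom (suc (j + J)) (suc J)
    x<P : x < P
    x<P = ≰⇒> P≰x
    y≡ : y ≡ P′ + (P ∸ x)
    y≡ = +-cancelˡ-≡ x y _ (begin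
      x + y                                          ≡⟨ x+y≡ ⟩
      binom (suc (j + J)) j + P                      ≡⟨ cong (_+ P) (binom-sym-suc j J) ⟩
      P′ + P                                         ≡⟨ cong (P′ +_) (sym (m+[n∸m]≡n (<⇒≤ x<P))) ⟩
      P′ + (x + (P ∸ x))                             ≡⟨ +-exchange P′ x (P ∸ x) ⟩
      x + (P′ + (P ∸ x))                             ∎)
      where open ≡-Reasoning

  complement-top-in-x : ∀ j J x' y → x' + y ≡ binom (suc (j + J)) j →
    ∂ (suc j) (binom (suc (j + J)) (suc j) + x') + y ≡ binom (suc (j + J)) (suc J) + ∂ (suc J) y
  complement-top-in-x j J x' zero x'≡ = begin
    ∂ (suc j) (binom (suc L) (suc j) + x') + 0       ≡⟨ +-identityʳ _ ⟩
    ∂ (suc j) (binom (suc L) (suc j) + x')           ≡⟨ cong (λ t → ∂ (suc j) (binom (suc L) (suc j) + t))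
                                                          (trans (sym (+-identityʳ x')) x'≡) ⟩
    ∂ (suc j) (binom (suc L) (suc j) + binom (suc L) j)
                                                     ≡⟨ cong (∂ (suc j)) (+-comm (binom (suc L) (suc j)) _) ⟩
    ∂ (suc j) (binom (suc (suc L)) (suc j))          ≡⟨ ∂-binom (suc L) j ⟩
    binom (suc L) j                                  ≡⟨ binom-sym-suc j J ⟩
    binom (suc L) (suc J)                            ≡⟨ sym (+-identityʳ _) ⟩
    binom (suc L) (suc J) + 0                        ≡⟨ cong (binom (suc L) (suc J) +_) (sym (∂-zero (suc J))) ⟩
    binom (suc L) (suc J) + ∂ (suc J) 0              ∎
    where
    open ≡-Reasoning
    L = j + J
  complement-top-in-x j J x' (suc y) x'≡ = begin
    ∂ (suc j) (binom (suc L) (suc j) + x') + suc y   ≡⟨ cong (_+ suc y) (∂-cascade j (suc L) x' x'<B) ⟩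
    predBinom (suc L) j + ∂ j x' + suc y             ≡⟨ cong (λ t → t + ∂ j x' + suc y) (predBinom-suc L j) ⟩
    binom L j + ∂ j x' + suc y                       ≡⟨ +-assoc (binom L j) (∂ j x') (suc y) ⟩
    binom L j + (∂ j x' + suc y)                     ≡⟨ cong₂ _+_ (binom-sym j J) complement ⟩
    binom L J + (binom L (suc J) + ∂ (suc J) (suc y))
                                                     ≡⟨ sym (+-assoc (binom L J) (binom L (suc J)) _) ⟩
    binom (suc L) (suc J) + ∂ (suc J) (suc y)        ∎
    where
    open ≡-Reasoning
    L = j + J
    x'<B : x' < binom (suc L) j
    x'<B = subst (x' <_) x'≡ (m<m+n x' z<s)
    complement : ∂ j x' + suc y ≡ binom L (suc J) + ∂ (suc J) (suc y)
    complement = begin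
      ∂ j x' + suc y                                 ≡⟨ ∂-complement j (suc J) x' (suc y)
                                                          (subst (1 ≤_) (sym (+-suc j J)) (s≤s z≤n))
                                                          (trans x'≡ (cong (λ t → binom t j) (sym (+-suc j J)))) ⟩
      predBinom (j + suc J) (suc J) + ∂ (suc J) (suc y)
                                                     ≡⟨ cong (λ t → predBinom t (suc J) + ∂ (suc J) (suc y)) (+-suc j J) ⟩
      predBinom (suc L) (suc J) + ∂ (suc J) (suc y)  ≡⟨ cong (_+ ∂ (suc J) (suc y)) (predBinom-suc L (suc J)) ⟩
      binom L (suc J) + ∂ (suc J) (suc y)            ∎

  complement-top-in-y : ∀ j J x y' → x + y' ≡ binom (suc (j + J)) (suc j) →
    ∂ (suc j) x + (binom (suc (j + J)) (suc J) + y') ≡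
      binom (suc (j + J)) (suc J) + ∂ (suc J) (binom (suc (j + J)) (suc J) + y')
  complement-top-in-y j J zero y' refl = begin
    ∂ (suc j) 0 + (P′ + P)                           ≡⟨ cong (_+ (P′ + P)) (∂-zero (suc j)) ⟩
    P′ + P                                           ≡⟨ cong (P′ +_) (trans (binom-sym (suc j) J) (sym (∂-binom (suc L) J))) ⟩
    P′ + ∂ (suc J) (binom (suc (suc L)) (suc J))     ≡⟨ cong (λ t → P′ + ∂ (suc J) t) (begin
      binom (suc L) J + P′                               ≡⟨ +-comm (binom (suc L) J) P′ ⟩
      P′ + binom (suc L) J                               ≡⟨ cong (P′ +_) (sym (binom-sym (suc j) J)) ⟩
      P′ + P                                             ∎) ⟩
    P′ + ∂ (suc J) (P′ + P)                          ∎
    where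
    open ≡-Reasoning
    L  = j + J
    P  = binom (suc L) (suc j)
    P′ = binom (suc L) (suc J)
  complement-top-in-y j J (suc x) y' x+y'≡ = begin
    ∂ (suc j) (suc x) + (P′ + y')                    ≡⟨ +-exchange (∂ (suc j) (suc x)) P′ y' ⟩
    P′ + (∂ (suc j) (suc x) + y')                    ≡⟨ cong (P′ +_) (∂-complement (suc j) J (suc x) y' (s≤s z≤n) x+y'≡) ⟩
    P′ + (predBinom (suc L) J + ∂ J y')              ≡⟨ cong (P′ +_) (sym (∂-cascade J (suc L) y' y'<B)) ⟩
    P′ + ∂ (suc J) (P′ + y')                         ∎
    where
    open ≡-Reasoning
    L  = j + J
    P′ = binom (suc L) (suc J)
    y'<B : y' < binom (suc L) J
    y'<B = subst (y' <_) (trans x+y'≡ (binom-sym (suc j) J))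
                 (m<n+m y' z<s)

∂-complement′ : ∀ j M → 1 ≤ M → j ≤ M → ∀ x y → x + y ≡ binom M j →
                ∂ j x + y ≡ predBinom M (M ∸ j) + ∂ (M ∸ j) y
∂-complement′ j M 1≤M j≤M x y x+y≡ =
  subst (λ t → ∂ j x + y ≡ predBinom t (M ∸ j) + ∂ (M ∸ j) y) j+J≡M
        (∂-complement j (M ∸ j) x y (subst (1 ≤_) (sym j+J≡M) 1≤M)
                      (trans x+y≡ (cong (λ t → binom t j) (sym j+J≡M))))
  where
  j+J≡M : j + (M ∸ j) ≡ M
  j+J≡M = m+[n∸m]≡n j≤M

-- A non-reduced top decomposition, whose remainder fills the whole level,
-- still obeys the cascade formula once the level is at least 2.
∂-cascade-≤ : ∀ k N m → m ≤ binom N (suc k) →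
              ∂ (suc (suc k)) (binom N (suc (suc k)) + m) ≡ predBinom N (suc k) + ∂ (suc k) m
∂-cascade-≤ k N m m≤B with m≤n⇒m<n∨m≡n m≤B
... | inj₁ m<B = ∂-cascade (suc k) N m m<B
... | inj₂ refl = begin
  ∂ (suc (suc k)) (binom N (suc (suc k)) + binom N (suc k))
    ≡⟨ cong (∂ (suc (suc k))) (+-comm (binom N (suc (suc k))) (binom N (suc k))) ⟩
  ∂ (suc (suc k)) (binom (suc N) (suc (suc k)))  ≡⟨ ∂-binom N (suc k) ⟩
  binom N (suc k)                                ≡⟨ binom-split N k ⟩
  predBinom N (suc k) + ∂ (suc k) (binom N (suc k)) ∎
  where open ≡-Reasoning

-- Removing 1 ≤ c < binom M k elements from binom (M+1) (k+1) = binom M (k+1) + binom M k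
-- leaves binom M (k+1) + r with r = binom M k - c, which cascades.
∂-after-removal : ∀ k M x c → x + c ≡ binom (suc M) (suc k) → 1 ≤ c → c < binom M k →
                  ∂ (suc k) x ≡ predBinom M k + ∂ k (binom M k ∸ c)
∂-after-removal k M x c x+c≡ 1≤c c<B = trans (cong (∂ (suc k)) x≡) (∂-cascade k M r (∸-monoʳ-< 1≤c (<⇒≤ c<B)))
  where
  open ≡-Reasoning
  r = binom M k ∸ c
  x≡ : x ≡ binom M (suc k) + r
  x≡ = +-cancelʳ-≡ c x (binom M (suc k) + r) (begin
    x + c                            ≡⟨ x+c≡ ⟩
    binom M k + binom M (suc k)      ≡⟨ +-comm (binom M k) (binom M (suc k)) ⟩
    binom M (suc k) + binom M k      ≡⟨ cong (binom M (suc k) +_) (sym (m∸n+n≡m (<⇒≤ c<B))) ⟩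
    binom M (suc k) + (r + c)        ≡⟨ sym (+-assoc (binom M (suc k)) r c) ⟩
    binom M (suc k) + r + c          ∎)

-- The statements proved by one simultaneous induction on a bound g for the
-- size of the arguments (and, inside, on the level).

Subadditive : ℕ → ℕ → Set
Subadditive i g = ∀ x y → x + y < g → ∂ i (x + y) ≤ ∂ i x + ∂ i y

Dominated : ℕ → ℕ → Set
Dominated i g = ∀ y → y < g → ∂ i y ≤ ∂ (suc i) y

ShadowInequality : ℕ → ℕ → Set
ShadowInequality k g =
  ∀ a b → a + b < g → a < ∂ (suc k) (a + b) → ∂ (suc k) (a + b) ≤ ∂ k a + ∂ (suc k) b

-- Exchange: moving c elements from a complete level Q = binom M j onto a partner
-- m < binom (M+1) j does not decrease the total shadow, provided m + c stays
-- below Q + ∂ j m (the form the hypothesis a < ∂ n takes after one cascade step).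
ExchangeAt : ℕ → ℕ → ℕ → ℕ → Set
ExchangeAt j g M m = ∀ r c → binom M j + m < g → m < binom (suc M) j →
  r + c ≡ binom M j → 1 ≤ c → m + c < binom M j + ∂ j m →
  ∂ j (binom M j) + ∂ j m ≤ ∂ j r + ∂ j (m + c)

Exchange : ℕ → ℕ → Set
Exchange j g = ∀ M m → ExchangeAt j g M m

-- Exchange restricted to a nonempty partner m; the case m = 0 is subadditivity.
Exchange⁺ : ℕ → ℕ → Set
Exchange⁺ j g = ∀ M m → 1 ≤ m → ExchangeAt j g M m

shrink : ∀ {a b g} → 1 ≤ a → a + b < suc g → b < g
shrink {a} {b} 1≤a a+b<g+1 = ≤-trans (+-monoˡ-≤ b 1≤a) (≤-pred a+b<g+1)

subadditive-swap : ∀ i x y → ∂ i (y + x) ≤ ∂ i y + ∂ i x → ∂ i (x + y) ≤ ∂ i x + ∂ i y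
subadditive-swap i x y = subst₂ _≤_ (cong (∂ i) (+-comm y x)) (+-comm (∂ i y) (∂ i x))

-- Level 1: ∂ 1 is 0 at 0 and 1 elsewhere.
∂₁-subadditive : ∀ x y → ∂ 1 (x + y) ≤ ∂ 1 x + ∂ 1 y
∂₁-subadditive zero    y       = ≤-reflexive (cong (_+ ∂ 1 y) (sym (∂-zero 1)))
∂₁-subadditive (suc x) zero    = subst (λ t → ∂ 1 t ≤ ∂ 1 (suc x) + ∂ 1 0) (sym (+-identityʳ (suc x)))
                                       (m≤m+n _ _)
∂₁-subadditive (suc x) (suc y) = ≤-trans (∂₁≤1 (suc x + suc y))
                                         (subst (λ t → 1 ≤ t + ∂ 1 (suc y)) (sym (∂₁-suc x)) (s≤s z≤n))

-- Subadditivity when the top block binom N (k+1) of x + y = binom N (k+1) + m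
-- lies inside x: peel it off x and use subadditivity one level down.
subadditive-top-in-x : ∀ f k N m x y → Subadditive (suc k) (suc f) → Dominated (suc k) f →
  m ≤ binom N (suc k) → x + y ≡ binom N (suc (suc k)) + m → binom N (suc (suc k)) ≤ x →
  1 ≤ x → 1 ≤ y → x + y < suc f → ∂ (suc (suc k)) (x + y) ≤ ∂ (suc (suc k)) x + ∂ (suc (suc k)) y
subadditive-top-in-x f k N m x y sub dom m≤B x+y≡ P≤x 1≤x 1≤y x+y<f+1 with m≤n⇒∃[o]m+o≡n P≤x
... | x' , refl = begin
  ∂ K (P + x' + y)                 ≡⟨ cong (∂ K) x+y≡ ⟩
  ∂ K (P + m)                      ≡⟨ ∂-cascade-≤ k N m m≤B ⟩
  predBinom N k' + ∂ k' m          ≡⟨ cong (λ t → predBinom N k' + ∂ k' t) (sym x'+y≡m) ⟩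
  predBinom N k' + ∂ k' (x' + y)   ≤⟨ +-monoʳ-≤ (predBinom N k') (sub x' y x'+y<f+1) ⟩
  predBinom N k' + (∂ k' x' + ∂ k' y)
                                   ≤⟨ +-monoʳ-≤ (predBinom N k') (+-monoʳ-≤ (∂ k' x')
                                        (dom y (shrink 1≤x x+y<f+1))) ⟩
  predBinom N k' + (∂ k' x' + ∂ K y)
                                   ≡⟨ sym (+-assoc (predBinom N k') (∂ k' x') (∂ K y)) ⟩
  predBinom N k' + ∂ k' x' + ∂ K y ≡⟨ cong (_+ ∂ K y) (sym (∂-cascade k' N x' x'<B)) ⟩
  ∂ K (P + x') + ∂ K y             ∎
  where
  open ≤-Reasoning
  k' = suc k
  K  = suc k'
  P  = binom N K
  x'+y≡m : x' + y ≡ m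
  x'+y≡m = +-cancelˡ-≡ P (x' + y) m (trans (sym (+-assoc P x' y)) x+y≡)
  x'<B : x' < binom N k'
  x'<B = <-≤-trans (subst (x' <_) x'+y≡m (m<m+n x' 1≤y)) m≤B
  x'+y<f+1 : x' + y < suc f
  x'+y<f+1 = ≤-<-trans (m≤n+m (x' + y) P) (subst (_< suc f) (+-assoc P x' y) x+y<f+1)

-- Subadditivity when both x and y lie below the top block Q = binom N K of
-- x + y = Q + m: exchange Q - y elements of Q onto m, which turns (Q, m) into (y, x).
subadditive-below-top : ∀ g K N m x y → Exchange⁺ K g → binom N K + m < g →
  1 ≤ m → m < binom (suc N) K → x + y ≡ binom N K + m → x < binom N K → y < binom N K →
  ∂ K (binom N K) + ∂ K m ≤ ∂ K x + ∂ K y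
subadditive-below-top g K N m x y ex size 1≤m m<B x+y≡ x<Q y<Q = begin
  ∂ K Q + ∂ K m        ≤⟨ ex N m 1≤m y c size m<B (m+[n∸m]≡n (<⇒≤ y<Q)) (m<n⇒0<n∸m y<Q)
                              (subst (_< Q + ∂ K m) (sym m+c≡x) (≤-trans x<Q (m≤m+n Q _))) ⟩
  ∂ K y + ∂ K (m + c)  ≡⟨ cong (λ t → ∂ K y + ∂ K t) m+c≡x ⟩
  ∂ K y + ∂ K x        ≡⟨ +-comm (∂ K y) (∂ K x) ⟩
  ∂ K x + ∂ K y        ∎
  where
  open ≤-Reasoning
  Q = binom N K
  c = Q ∸ y
  m+c≡x : m + c ≡ x
  m+c≡x = begin-equality
    m + (Q ∸ y)        ≡⟨ sym (+-∸-assoc m (<⇒≤ y<Q)) ⟩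
    m + Q ∸ y          ≡⟨ cong (_∸ y) (trans (+-comm m Q) (sym x+y≡)) ⟩
    x + y ∸ y          ≡⟨ m+n∸n≡m x y ⟩
    x                  ∎

-- Subadditivity at level K = k + 2 for a decomposition x + y = binom N K + m with
-- 1 ≤ m ≤ binom N (K-1): either the block binom N K fits in x or in y, or both
-- lie below it.
subadditive-split : ∀ f k N m x y → Subadditive (suc k) (suc f) → Dominated (suc k) f →
  Exchange⁺ (suc (suc k)) (suc f) → 1 ≤ m → m ≤ binom N (suc k) →
  x + y ≡ binom N (suc (suc k)) + m → 1 ≤ x → 1 ≤ y → x + y < suc f →
  ∂ (suc (suc k)) (x + y) ≤ ∂ (suc (suc k)) x + ∂ (suc (suc k)) y
subadditive-split f k N m x y sub dom ex 1≤m m≤B x+y≡ 1≤x 1≤y x+y<f+1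
  with binom N (suc (suc k)) ≤? x | binom N (suc (suc k)) ≤? y
... | yes P≤x | _ = subadditive-top-in-x f k N m x y sub dom m≤B x+y≡ P≤x 1≤x 1≤y x+y<f+1
... | no _ | yes P≤y = subadditive-swap (suc (suc k)) x y
  (subadditive-top-in-x f k N m y x sub dom m≤B (trans (+-comm y x) x+y≡) P≤y 1≤y 1≤x
                        (subst (_< suc f) (+-comm x y) x+y<f+1))
... | no P≰x | no P≰y = begin
  ∂ K (x + y)                          ≡⟨ cong (∂ K) x+y≡ ⟩
  ∂ K (P + m)                          ≡⟨ ∂-cascade-≤ k N m m≤B ⟩
  predBinom N (suc k) + ∂ (suc k) m    ≤⟨ +-monoʳ-≤ (predBinom N (suc k)) (dom m (shrink 1≤P size)) ⟩
  predBinom N (suc k) + ∂ K m          ≡⟨ cong (_+ ∂ K m) (sym (∂-binom′ N (suc k))) ⟩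
  ∂ K P + ∂ K m                        ≤⟨ subadditive-below-top (suc f) K N m x y ex size 1≤m
                                            (≤-<-trans m≤B (m<m+n _ 1≤P)) x+y≡ (≰⇒> P≰x) (≰⇒> P≰y) ⟩
  ∂ K x + ∂ K y                        ∎
  where
  open ≤-Reasoning
  K = suc (suc k)
  P = binom N K
  size : P + m < suc f
  size = subst (_< suc f) x+y≡ x+y<f+1
  1≤P : 1 ≤ P
  1≤P = ≤-trans (s≤s z≤n) (≰⇒> P≰x)

-- Subadditivity at level k + 2 from the statements at level k + 1.  The
-- decomposition used is the top decomposition of x + y - 1, plus one.
subadditive-step : ∀ f k → Subadditive (suc k) (suc f) → Dominated (suc k) f →
  Exchange⁺ (suc (suc k)) (suc f) → Subadditive (suc (suc k)) (suc f)
subadditive-step f k sub dom ex zero y _ = ≤-reflexive (cong (_+ ∂ (suc (suc k)) y) (sym (∂-zero (suc (suc k)))))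
subadditive-step f k sub dom ex (suc x) zero _ =
  subst (λ t → ∂ (suc (suc k)) t ≤ ∂ (suc (suc k)) (suc x) + ∂ (suc (suc k)) 0)
        (sym (+-identityʳ (suc x))) (m≤m+n _ _)
subadditive-step f k sub dom ex (suc x) (suc y) x+y<f+1 with topDecomposition (suc k) (x + suc y)
... | top N m _ m<B split = subadditive-split f k N (suc m) (suc x) (suc y) sub dom ex (s≤s z≤n) m<B
  (trans (cong suc split) (sym (+-suc (binom N (suc (suc k))) m))) (s≤s z≤n) (s≤s z≤n) x+y<f+1

-- Subadditivity bounds the level-i shadow of a complete level i + 1 by the
-- level-(i+1) shadow: ∂ i (binom N (i+1)) ≤ binom (N-1) i.  Induction on N with
-- Pascal's rule.
∂-binom-below : ∀ g i N → Subadditive i g → binom N (suc i) < g →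
                ∂ i (binom N (suc i)) ≤ predBinom N i
∂-binom-below g i       zero    sub _ = ≤-reflexive (∂-zero i)
∂-binom-below g zero    (suc M) sub _ = z≤n
∂-binom-below g (suc i) (suc M) sub size = begin
  ∂ (suc i) (binom M (suc i) + binom M (suc (suc i)))
    ≤⟨ sub (binom M (suc i)) (binom M (suc (suc i))) size ⟩
  ∂ (suc i) (binom M (suc i)) + ∂ (suc i) (binom M (suc (suc i)))
    ≤⟨ +-mono-≤ (≤-reflexive (∂-binom′ M i)) (∂-binom-below g (suc i) M sub (≤-<-trans (m≤n+m _ _) size)) ⟩
  predBinom M i + predBinom M (suc i)
    ≡⟨ predBinom-pascal M i ⟩
  predBinom (suc M) (suc i) ∎
  where open ≤-Reasoning

-- Subadditivity of ∂ i gives ∂ i ≤ ∂ (i+1): apply it to the top decomposition.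
dominated-from-subadditive : ∀ g i → Subadditive i g → Dominated i g
dominated-from-subadditive g i sub y y<g with topDecomposition i y
... | top N m _ m<B refl = begin
  ∂ i (binom N (suc i) + m)          ≤⟨ sub (binom N (suc i)) m y<g ⟩
  ∂ i (binom N (suc i)) + ∂ i m      ≤⟨ +-monoˡ-≤ (∂ i m) (∂-binom-below g i N sub (≤-<-trans (m≤m+n _ m) y<g)) ⟩
  predBinom N i + ∂ i m              ≡⟨ sym (∂-cascade i N m m<B) ⟩
  ∂ (suc i) (binom N (suc i) + m)    ∎
  where open ≤-Reasoning

-- With an empty partner the exchange inequality is just subadditivity.
exchange-from-exchange⁺ : ∀ g j → Subadditive j g → Exchange⁺ j g → Exchange j g
exchange-from-exchange⁺ g j sub ex M zero r c size _ r+c≡Q _ _ = begin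
  ∂ j (binom M j) + ∂ j 0     ≡⟨ cong₂ _+_ (cong (∂ j) (sym r+c≡Q)) (∂-zero j) ⟩
  ∂ j (r + c) + 0             ≡⟨ +-identityʳ _ ⟩
  ∂ j (r + c)                 ≤⟨ sub r c (subst (_< g) (trans (+-identityʳ _) (sym r+c≡Q)) size) ⟩
  ∂ j r + ∂ j c               ≡⟨ cong (∂ j r +_) (cong (∂ j) (sym (+-identityˡ c))) ⟩
  ∂ j r + ∂ j (0 + c)         ∎
  where open ≤-Reasoning
exchange-from-exchange⁺ g j sub ex M (suc m) = ex M (suc m) (s≤s z≤n)

-- At level 0 a partner m < binom (M+1) 0 = 1 is empty.
exchange⁺-zero : ∀ g → Exchange⁺ 0 g
exchange⁺-zero g M m 1≤m r c _ m<1 = ⊥-elim (<⇒≱ m<1 1≤m)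

-- At level 0 the hypothesis a < ∂ 1 n ≤ 1 forces a = 0.
shadow-inequality-zero : ∀ g → ShadowInequality 0 g
shadow-inequality-zero g zero    b _ _   = ≤-refl
shadow-inequality-zero g (suc a) b _ a<∂ = ⊥-elim (<⇒≱ (≤-trans a<∂ (∂₁≤1 (suc a + b))) (s≤s z≤n))

-- Exchange, case m < r: complement everything inside the complete level
-- Q = binom M j.  With u = r - m we have m + (c + u) = Q, and by duality each
-- of the four shadows becomes ∂Q + ∂ J (…) for J = M - j and ∂Q = binom (M-1) J = ∂ j Q;
-- the claim then reduces to subadditivity of ∂ J on c + u.
exchange-small-partner : ∀ f i M m r c → (∀ J → Subadditive J f) →
  binom M (suc i) + m < suc f → 1 ≤ m → r + c ≡ binom M (suc i) → m < r →
  ∂ (suc i) (binom M (suc i)) + ∂ (suc i) m ≤ ∂ (suc i) r + ∂ (suc i) (m + c)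
exchange-small-partner f i M m r c sub size 1≤m r+c≡Q m<r = +-cancelʳ-≤ (c + u) _ _ (begin
  (∂ j Q + ∂ j m) + (c + u)          ≡⟨ +-assoc (∂ j Q) (∂ j m) (c + u) ⟩
  ∂ j Q + (∂ j m + (c + u))          ≡⟨ cong₂ _+_ ∂Q-value (dual m (c + u) m+c+u≡Q) ⟩
  ∂Q + (∂Q + ∂ J (c + u))            ≤⟨ +-monoʳ-≤ ∂Q (+-monoʳ-≤ ∂Q (sub J c u c+u<f)) ⟩
  ∂Q + (∂Q + (∂ J c + ∂ J u))        ≡⟨ sym (+-assoc ∂Q ∂Q _) ⟩
  (∂Q + ∂Q) + (∂ J c + ∂ J u)        ≡⟨ +-interchange ∂Q ∂Q (∂ J c) (∂ J u) ⟩
  (∂Q + ∂ J c) + (∂Q + ∂ J u)        ≡⟨ sym (cong₂ _+_ (dual r c r+c≡Q) (dual (m + c) u (trans (+-assoc m c u) m+c+u≡Q))) ⟩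
  (∂ j r + c) + (∂ j (m + c) + u)    ≡⟨ +-interchange (∂ j r) c (∂ j (m + c)) u ⟩
  (∂ j r + ∂ j (m + c)) + (c + u)    ∎)
  where
  open ≤-Reasoning
  j = suc i
  Q = binom M j
  u = r ∸ m
  m+c+u≡Q : m + (c + u) ≡ Q
  m+c+u≡Q = begin-equality
    m + (c + u)       ≡⟨ +-exchange m c u ⟩
    c + (m + u)       ≡⟨ cong (c +_) (m+[n∸m]≡n (<⇒≤ m<r)) ⟩
    c + r             ≡⟨ +-comm c r ⟩
    r + c             ≡⟨ r+c≡Q ⟩
    Q                 ∎
  1≤Q : 1 ≤ Q
  1≤Q = subst (1 ≤_) m+c+u≡Q (≤-trans 1≤m (m≤m+n m _))
  1≤M : ∀ M → 1 ≤ binom M (suc i) → 1 ≤ M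
  1≤M zero    ()
  1≤M (suc M) _ = s≤s z≤n
  J = M ∸ j
  ∂Q = predBinom M J
  dual : ∀ x y → x + y ≡ Q → ∂ j x + y ≡ ∂Q + ∂ J y
  dual = ∂-complement′ j M (1≤M M 1≤Q) (binom-pos⇒≤ M j 1≤Q)
  ∂Q-value : ∂ j Q ≡ ∂Q
  ∂Q-value = begin-equality
    ∂ j Q             ≡⟨ sym (+-identityʳ _) ⟩
    ∂ j Q + 0         ≡⟨ dual Q 0 (+-identityʳ Q) ⟩
    ∂Q + ∂ J 0        ≡⟨ cong (∂Q +_) (∂-zero J) ⟩
    ∂Q + 0            ≡⟨ +-identityʳ ∂Q ⟩
    ∂Q                ∎
  c+u<f : c + u < f
  c+u<f = shrink 1≤m (≤-<-trans (≤-reflexive m+c+u≡Q) (≤-<-trans (m≤m+n Q m) size))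

-- Exchange, case r ≤ m < Q: with x = m - r we get m + c = Q + x, and the claim
-- is the shadow inequality one level down for the pair (x, r).
exchange-medium-partner : ∀ f i M m r c → ShadowInequality i f →
  binom M (suc i) + m < suc f → r + c ≡ binom M (suc i) → m < binom M (suc i) → r ≤ m →
  m + c < binom M (suc i) + ∂ (suc i) m →
  ∂ (suc i) (binom M (suc i)) + ∂ (suc i) m ≤ ∂ (suc i) r + ∂ (suc i) (m + c)
exchange-medium-partner f i zero    m r c ineq size r+c≡Q () r≤m cond
exchange-medium-partner f i (suc M) m r c ineq size r+c≡Q m<Q r≤m cond = begin
  ∂ j Q + ∂ j m                     ≡⟨ cong₂ _+_ (∂-binom M i) (cong (∂ j) (sym x+r≡m)) ⟩
  binom M i + ∂ j (x + r)           ≤⟨ +-monoʳ-≤ (binom M i) (ineq x r (subst (_< f) (sym x+r≡m) m<f)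
                                         (subst (λ t → x < ∂ j t) (sym x+r≡m) x<∂m)) ⟩
  binom M i + (∂ i x + ∂ j r)       ≡⟨ cong (binom M i +_) (+-comm (∂ i x) (∂ j r)) ⟩
  binom M i + (∂ j r + ∂ i x)       ≡⟨ +-exchange (binom M i) (∂ j r) (∂ i x) ⟩
  ∂ j r + (binom M i + ∂ i x)       ≡⟨ cong (∂ j r +_) (sym ∂m+c) ⟩
  ∂ j r + ∂ j (m + c)               ∎
  where
  open ≤-Reasoning
  j = suc i
  Q = binom (suc M) j
  x = m ∸ r
  x+r≡m : x + r ≡ m
  x+r≡m = m∸n+n≡m r≤m
  m+c≡Q+x : m + c ≡ Q + x
  m+c≡Q+x = begin-equality
    m + c             ≡⟨ cong (_+ c) (sym x+r≡m) ⟩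
    x + r + c         ≡⟨ +-assoc x r c ⟩
    x + (r + c)       ≡⟨ cong (x +_) r+c≡Q ⟩
    x + Q             ≡⟨ +-comm x Q ⟩
    Q + x             ∎
  x<∂m : x < ∂ j m
  x<∂m = +-cancelˡ-< Q x (∂ j m) (subst (_< Q + ∂ j m) m+c≡Q+x cond)
  x<B : x < binom (suc M) i
  x<B = <-≤-trans x<∂m (begin
    ∂ j m             ≤⟨ ∂-mono j (<⇒≤ m<Q) ⟩
    ∂ j Q             ≡⟨ ∂-binom M i ⟩
    binom M i         ≤⟨ binom-suc-≤ M i ⟩
    binom (suc M) i   ∎)
  ∂m+c : ∂ j (m + c) ≡ binom M i + ∂ i x
  ∂m+c = begin-equality
    ∂ j (m + c)                   ≡⟨ cong (∂ j) m+c≡Q+x ⟩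
    ∂ j (Q + x)                   ≡⟨ ∂-cascade i (suc M) x x<B ⟩
    predBinom (suc M) i + ∂ i x   ≡⟨ cong (_+ ∂ i x) (predBinom-suc M i) ⟩
    binom M i + ∂ i x             ∎
  m<f : m < f
  m<f = shrink (≤-trans (s≤s z≤n) m<Q) size

-- Exchange, case Q ≤ m, main computation at level k + 1 with k = i + 1.  Here
-- Q = binom (M+1) (k+1) splits by Pascal's rule as binom M k + binom M (k+1); the
-- partner Q + m' and the donor r = binom M (k+1) + r' both cascade, and what
-- remains is the exchange at level k for the complete level binom M k, the
-- partner m' and the donor r'.
exchange-large-partner-cascade : ∀ f i M m' r c → Exchange (suc i) (suc f) →
  binom (suc M) (suc (suc i)) + (binom (suc M) (suc (suc i)) + m') < suc f →
  m' < binom (suc M) (suc i) → r + c ≡ binom (suc M) (suc (suc i)) → 1 ≤ c →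
  c < binom M (suc i) → m' + c < binom M (suc i) + ∂ (suc i) m' →
  ∂ (suc (suc i)) (binom (suc M) (suc (suc i))) + ∂ (suc (suc i)) (binom (suc M) (suc (suc i)) + m') ≤
    ∂ (suc (suc i)) r + ∂ (suc (suc i)) (binom (suc M) (suc (suc i)) + m' + c)
exchange-large-partner-cascade f i M m' r c ex size m'<B r+c≡Q 1≤c c<B cond = begin
  ∂ j Q + ∂ j (Q + m')
    ≡⟨ cong₂ _+_ (∂-binom M k) (trans (∂-cascade k (suc M) m' m'<B) (cong (_+ ∂ k m') (predBinom-suc M k))) ⟩
  binom M k + (binom M k + ∂ k m')
    ≡⟨ cong (λ t → binom M k + (t + ∂ k m')) (binom-split M i) ⟩
  binom M k + ((predBinom M k + ∂ k (binom M k)) + ∂ k m')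
    ≡⟨ cong (binom M k +_) (+-assoc (predBinom M k) _ _) ⟩
  binom M k + (predBinom M k + (∂ k (binom M k) + ∂ k m'))
    ≤⟨ +-monoʳ-≤ (binom M k) (+-monoʳ-≤ (predBinom M k) (ex M m' r' c size′ m'<B r'+c≡ 1≤c cond)) ⟩
  binom M k + (predBinom M k + (∂ k r' + ∂ k (m' + c)))
    ≡⟨ cong (binom M k +_) (sym (+-assoc (predBinom M k) _ _)) ⟩
  binom M k + ((predBinom M k + ∂ k r') + ∂ k (m' + c))
    ≡⟨ +-exchange (binom M k) (predBinom M k + ∂ k r') (∂ k (m' + c)) ⟩
  (predBinom M k + ∂ k r') + (binom M k + ∂ k (m' + c))
    ≡⟨ cong₂ _+_ (sym ∂r) (sym ∂Q+m'+c) ⟩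
  ∂ j r + ∂ j (Q + m' + c) ∎
  where
  open ≤-Reasoning
  k = suc i
  j = suc k
  Q = binom (suc M) j
  r' = binom M k ∸ c
  r'+c≡ : r' + c ≡ binom M k
  r'+c≡ = m∸n+n≡m (<⇒≤ c<B)
  ∂r : ∂ j r ≡ predBinom M k + ∂ k r'
  ∂r = ∂-after-removal k M r c r+c≡Q 1≤c c<B
  m'+c<B : m' + c < binom (suc M) k
  m'+c<B = <-≤-trans cond (begin
    binom M k + ∂ k m'                      ≤⟨ +-monoʳ-≤ (binom M k) (∂-mono k (<⇒≤ m'<B)) ⟩
    binom M k + ∂ k (binom (suc M) k)       ≡⟨ cong (binom M k +_) (∂-binom M i) ⟩
    binom M k + binom M i                   ≡⟨ +-comm (binom M k) (binom M i) ⟩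
    binom (suc M) k                         ∎)
  ∂Q+m'+c : ∂ j (Q + m' + c) ≡ binom M k + ∂ k (m' + c)
  ∂Q+m'+c = begin-equality
    ∂ j (Q + m' + c)                        ≡⟨ cong (∂ j) (+-assoc Q m' c) ⟩
    ∂ j (Q + (m' + c))                      ≡⟨ ∂-cascade k (suc M) (m' + c) m'+c<B ⟩
    predBinom (suc M) k + ∂ k (m' + c)      ≡⟨ cong (_+ ∂ k (m' + c)) (predBinom-suc M k) ⟩
    binom M k + ∂ k (m' + c)                ∎
  size′ : binom M k + m' < suc f
  size′ = ≤-<-trans (+-monoˡ-≤ m' (≤-trans (m≤m+n (binom M k) (binom M j)) (m≤m+n Q Q)))
                    (subst (_< suc f) (sym (+-assoc Q Q m')) size)

-- Exchange, case Q ≤ m: write m = Q + m'.  Then c < binom (M-1) i, which rules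
-- out M = 0 and i = 0 and leaves the main computation above.
exchange-large-partner : ∀ f i M m r c → Exchange i (suc f) → binom M (suc i) + m < suc f →
  m < binom (suc M) (suc i) → r + c ≡ binom M (suc i) → 1 ≤ c → binom M (suc i) ≤ m →
  m + c < binom M (suc i) + ∂ (suc i) m →
  ∂ (suc i) (binom M (suc i)) + ∂ (suc i) m ≤ ∂ (suc i) r + ∂ (suc i) (m + c)
exchange-large-partner f i M m r c ex size m<B r+c≡Q 1≤c Q≤m cond with m≤n⇒∃[o]m+o≡n Q≤m
... | m' , refl = split M i ex size m'<B r+c≡Q cond′ c<B
  where
  Q = binom M (suc i)
  m'<B : m' < binom M i
  m'<B = +-cancelˡ-< Q m' (binom M i) (subst (Q + m' <_) (+-comm (binom M i) Q) m<B)
  cond′ : m' + c < predBinom M i + ∂ i m'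
  cond′ = +-cancelˡ-< Q (m' + c) _
            (subst₂ _<_ (+-assoc Q m' c) (cong (Q +_) (∂-cascade i M m' m'<B)) cond)
  c<B : c < predBinom M i
  c<B = +-cancelʳ-< m' c (predBinom M i)
          (subst (_< predBinom M i + m') (+-comm m' c) (<-≤-trans cond′ (+-monoʳ-≤ _ (∂≤id i m'))))
  split : ∀ M i → Exchange i (suc f) → binom M (suc i) + (binom M (suc i) + m') < suc f →
    m' < binom M i → r + c ≡ binom M (suc i) → m' + c < predBinom M i + ∂ i m' → c < predBinom M i →
    ∂ (suc i) (binom M (suc i)) + ∂ (suc i) (binom M (suc i) + m') ≤
      ∂ (suc i) r + ∂ (suc i) (binom M (suc i) + m' + c)
  split zero     i        _  _    _    _     _     ()
  split (suc M′) zero     _  _    _    _     _     c<1 = ⊥-elim (<⇒≱ c<1 1≤c)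
  split (suc M′) (suc i′) ex size m'<B r+c≡Q cond′ c<B =
    exchange-large-partner-cascade f i′ M′ m' r c ex size m'<B r+c≡Q 1≤c
      (subst (c <_) (predBinom-suc M′ (suc i′)) c<B)
      (subst (m' + c <_) (cong (_+ ∂ (suc i′) m') (predBinom-suc M′ (suc i′))) cond′)

exchange⁺-step : ∀ f i → Exchange i (suc f) → ShadowInequality i f → (∀ J → Subadditive J f) →
                 Exchange⁺ (suc i) (suc f)
exchange⁺-step f i ex ineq sub M m 1≤m r c size m<B r+c≡Q 1≤c cond with binom M (suc i) ≤? m
... | yes Q≤m = exchange-large-partner f i M m r c ex size m<B r+c≡Q 1≤c Q≤m cond
... | no  Q≰m with r ≤? m
...   | yes r≤m = exchange-medium-partner f i M m r c ineq size r+c≡Q (≰⇒> Q≰m) r≤m cond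
...   | no  r≰m = exchange-small-partner f i M m r c sub size 1≤m r+c≡Q (≰⇒> r≰m)

-- The shadow inequality when a = m + c overshoots the remainder m of the top
-- decomposition a + b = binom (M+1) K + m (K = k + 1): then c + b fills
-- binom (M+1) K = binom M k + binom M K, so b = binom M K + r with r + c = binom M k,
-- and the claim is the exchange at level k moving c from binom M k onto m.
shadow-inequality-overshoot : ∀ g k M m c b → Exchange (suc k) g →
  m < binom (suc M) (suc k) → 1 ≤ c → c + b ≡ binom (suc M) (suc (suc k)) →
  binom (suc M) (suc (suc k)) + m < g → m + c < binom M (suc k) + ∂ (suc k) m →
  binom M (suc k) + ∂ (suc k) m ≤ ∂ (suc k) (m + c) + ∂ (suc (suc k)) b
shadow-inequality-overshoot g k′ M m c b ex m<B 1≤c c+b≡P size cond = begin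
  binom M k + ∂ k m                               ≡⟨ cong (_+ ∂ k m) (binom-split M k′) ⟩
  predBinom M k + ∂ k (binom M k) + ∂ k m         ≡⟨ +-assoc (predBinom M k) _ _ ⟩
  predBinom M k + (∂ k (binom M k) + ∂ k m)       ≤⟨ +-monoʳ-≤ (predBinom M k) (ex M m r c size′ m<B r+c≡ 1≤c cond) ⟩
  predBinom M k + (∂ k r + ∂ k (m + c))           ≡⟨ sym (+-assoc (predBinom M k) _ _) ⟩
  predBinom M k + ∂ k r + ∂ k (m + c)             ≡⟨ cong (_+ ∂ k (m + c)) (sym ∂b) ⟩
  ∂ K b + ∂ k (m + c)                             ≡⟨ +-comm (∂ K b) _ ⟩
  ∂ k (m + c) + ∂ K b                             ∎
  where
  open ≤-Reasoning
  k = suc k′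
  K = suc k
  c<B : c < binom M k
  c<B = +-cancelʳ-< m c (binom M k)
          (subst (_< binom M k + m) (+-comm m c) (<-≤-trans cond (+-monoʳ-≤ (binom M k) (∂≤id k m))))
  r = binom M k ∸ c
  r+c≡ : r + c ≡ binom M k
  r+c≡ = m∸n+n≡m (<⇒≤ c<B)
  ∂b : ∂ K b ≡ predBinom M k + ∂ k r
  ∂b = ∂-after-removal k M b c (trans (+-comm b c) c+b≡P) 1≤c c<B
  size′ : binom M k + m < g
  size′ = ≤-<-trans (+-monoˡ-≤ m (m≤m+n (binom M k) (binom M K))) size

-- The shadow inequality when a fits into the remainder m of the top decomposition
-- a + b = binom (M+1) K + m (K = k + 1): then b = binom (M+1) K + m' with
-- a + m' = m, and the claim is subadditivity of ∂ k on a + m'.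
shadow-inequality-inside : ∀ g k M m a b → Subadditive (suc k) g → m < binom (suc M) (suc k) →
  a + b ≡ binom (suc M) (suc (suc k)) + m → a ≤ m → a + b < g →
  ∂ (suc (suc k)) (a + b) ≤ ∂ (suc k) a + ∂ (suc (suc k)) b
shadow-inequality-inside g k′ M m a b sub m<B split a≤m a+b<g with m≤n⇒∃[o]m+o≡n a≤m
... | m' , refl = begin
  ∂ K (a + b)                            ≡⟨ cong (∂ K) split ⟩
  ∂ K (P + (a + m'))                     ≡⟨ cascade (a + m') m<B ⟩
  binom M k + ∂ k (a + m')               ≤⟨ +-monoʳ-≤ (binom M k) (sub a m' (≤-<-trans (m≤n+m _ P) (subst (_< g) split a+b<g))) ⟩
  binom M k + (∂ k a + ∂ k m')           ≡⟨ +-exchange (binom M k) (∂ k a) (∂ k m') ⟩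
  ∂ k a + (binom M k + ∂ k m')           ≡⟨ cong (∂ k a +_) (sym (cascade m' m'<B)) ⟩
  ∂ k a + ∂ K (P + m')                   ≡⟨ cong (λ t → ∂ k a + ∂ K t) (sym b≡) ⟩
  ∂ k a + ∂ K b                          ∎
  where
  open ≤-Reasoning
  k = suc k′
  K = suc k
  P = binom (suc M) K
  cascade : ∀ x → x < binom (suc M) k → ∂ K (P + x) ≡ binom M k + ∂ k x
  cascade x x<B = trans (∂-cascade k (suc M) x x<B) (cong (_+ ∂ k x) (predBinom-suc M k))
  m'<B : m' < binom (suc M) k
  m'<B = ≤-<-trans (m≤n+m m' a) m<B
  b≡ : b ≡ P + m'
  b≡ = +-cancelˡ-≡ a b (P + m') (trans split (+-exchange P a m'))

shadow-inequality-step : ∀ g k → Subadditive (suc k) g → Exchange (suc k) g → ShadowInequality (suc k) g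
shadow-inequality-step g k′ sub ex a b a+b<g a<∂ with topDecomposition (suc k′) (a + b)
... | top zero    m _ () _
... | top (suc M) m _ m<B split with a ≤? m
...   | yes a≤m = shadow-inequality-inside g k′ M m a b sub m<B split a≤m a+b<g
...   | no  a≰m = subst₂ _≤_ (sym ∂a+b) (cong (λ t → ∂ k t + ∂ K b) m+c≡a)
          (shadow-inequality-overshoot g k′ M m c b ex m<B (m<n⇒0<n∸m m<a) c+b≡P
                                       (subst (_< g) split a+b<g) (subst₂ _<_ (sym m+c≡a) ∂a+b a<∂))
  where
  open ≡-Reasoning
  k = suc k′
  K = suc k
  P = binom (suc M) K
  m<a : m < a
  m<a = ≰⇒> a≰m
  c = a ∸ m
  m+c≡a : m + c ≡ a
  m+c≡a = m+[n∸m]≡n (<⇒≤ m<a)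
  c+b≡P : c + b ≡ P
  c+b≡P = +-cancelˡ-≡ m (c + b) P (begin
    m + (c + b)    ≡⟨ sym (+-assoc m c b) ⟩
    m + c + b      ≡⟨ cong (_+ b) m+c≡a ⟩
    a + b          ≡⟨ split ⟩
    P + m          ≡⟨ +-comm P m ⟩
    m + P          ∎)
  ∂a+b : ∂ K (a + b) ≡ binom M k + ∂ k m
  ∂a+b = trans (cong (∂ K) split) (trans (∂-cascade k (suc M) m m<B) (cong (_+ ∂ k m) (predBinom-suc M k)))

-- The simultaneous induction: on the bound g and, for a fixed bound, on the level.
-- Subadditivity at level k + 2 needs the exchange at the same level and bound,
-- which in turn only uses statements at a lower level or a smaller bound.
mutual
  subadditive< : ∀ g i → Subadditive i g
  subadditive< zero    i                x y ()
  subadditive< (suc f) zero             x y _ = z≤n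
  subadditive< (suc f) (suc zero)       x y _ = ∂₁-subadditive x y
  subadditive< (suc f) (suc (suc k)) =
    subadditive-step f k (subadditive< (suc f) (suc k)) (dominated< f (suc k)) (exchange⁺< (suc f) (suc (suc k)))

  dominated< : ∀ g i → Dominated i g
  dominated< g i = dominated-from-subadditive g i (subadditive< g i)

  exchange⁺< : ∀ g j → Exchange⁺ j g
  exchange⁺< zero    j       M m _ r c ()
  exchange⁺< (suc f) zero    = exchange⁺-zero (suc f)
  exchange⁺< (suc f) (suc i) =
    exchange⁺-step f i (exchange< (suc f) i) (shadow-inequality< f i) (λ J → subadditive< f J)

  exchange< : ∀ g j → Exchange j g
  exchange< g j = exchange-from-exchange⁺ g j (subadditive< g j) (exchange⁺< g j)

  shadow-inequality< : ∀ g k → ShadowInequality k g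
  shadow-inequality< g zero    = shadow-inequality-zero g
  shadow-inequality< g (suc k) = shadow-inequality-step g k (subadditive< g (suc k)) (exchange< g (suc k))

∂-subadditive : ∀ i x y → ∂ i (x + y) ≤ ∂ i x + ∂ i y
∂-subadditive i x y = subadditive< (suc (x + y)) i x y ≤-refl

shadow-inequality : ∀ k a b → a < ∂ (suc k) (a + b) → ∂ (suc k) (a + b) ≤ ∂ k a + ∂ (suc k) b
shadow-inequality k a b = shadow-inequality< (suc (a + b)) k a b ≤-refl

∂-near-binom : ∀ k N s z → z + s ≡ binom N (suc k) → s + suc k ≤ N → ∂ (suc k) z ≡ predBinom N k
∂-near-binom zero    zero    s       z       _    s+1≤0 = ⊥-elim (<⇒≱ (subst (_≤ 0) (+-comm s 1) s+1≤0) z≤n)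
∂-near-binom zero    (suc N) s       zero    s≡   s+1≤ =
  ⊥-elim (<-irrefl (trans s≡ (binom-one (suc N))) (subst (_≤ suc N) (+-comm s 1) s+1≤))
∂-near-binom zero    (suc N) s       (suc z) _    _    = ∂₁-suc z
∂-near-binom (suc k) N       zero    z       z+0≡ _    =
  trans (cong (∂ (suc (suc k))) (trans (sym (+-identityʳ z)) z+0≡)) (∂-binom′ N (suc k))
∂-near-binom (suc k) (suc N) (suc s) z       z+s≡ s+K≤ = begin
  ∂ K z                                    ≡⟨ cong (∂ K) z≡ ⟩
  ∂ K (binom N K + z')                     ≡⟨ ∂-cascade k′ N z' (∸-monoʳ-< z<s s≤B) ⟩
  predBinom N k′ + ∂ k′ z'                 ≡⟨ cong (predBinom N k′ +_) (∂-near-binom k N (suc s) z' z'+s≡ s+k′≤N) ⟩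
  predBinom N k′ + predBinom N k           ≡⟨ +-comm (predBinom N k′) (predBinom N k) ⟩
  predBinom N k + predBinom N k′           ≡⟨ predBinom-pascal N k ⟩
  predBinom (suc N) k′                     ∎
  where
  open ≡-Reasoning
  k′ = suc k
  K  = suc k′
  s+k′≤N : suc s + k′ ≤ N
  s+k′≤N = ≤-pred (subst (_≤ suc N) (+-suc (suc s) k′) s+K≤)
  s≤B : suc s ≤ binom N k′
  s≤B = +-cancelʳ-≤ k′ (suc s) (binom N k′) (≤-trans s+k′≤N (binom-index-bound N k))
  z' = binom N k′ ∸ suc s
  z'+s≡ : z' + suc s ≡ binom N k′
  z'+s≡ = m∸n+n≡m s≤B
  z≡ : z ≡ binom N K + z'
  z≡ = +-cancelʳ-≡ (suc s) z (binom N K + z') (begin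
    z + suc s                              ≡⟨ z+s≡ ⟩
    binom N k′ + binom N K                 ≡⟨ +-comm (binom N k′) (binom N K) ⟩
    binom N K + binom N k′                 ≡⟨ cong (binom N K +_) (sym z'+s≡) ⟩
    binom N K + (z' + suc s)               ≡⟨ sym (+-assoc (binom N K) z' (suc s)) ⟩
    binom N K + z' + suc s                 ∎)

∂<id : ∀ j y → j < y → ∂ j y < y
∂<id zero    y 0<y = 0<y
∂<id (suc i) y i<y with topDecomposition i y
... | top N m i≤N m<B refl with m≤n⇒m<n∨m≡n i≤N
...   | inj₂ refl = ⊥-elim (<⇒≱ i<y (subst (_≤ suc i) (sym y≡0) z≤n))
  where
  y≡0 : binom i (suc i) + m ≡ 0
  y≡0 = cong₂ _+_ (binom-zero i (suc i) (n<1+n i)) (n<1⇒n≡0 (subst (m <_) (binom-diag i) m<B))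
...   | inj₁ (s≤s {n = N′} i≤N′) with m≤n⇒m<n∨m≡n i≤N′
...     | inj₁ i<N′ = begin-strict
  ∂ (suc i) (binom (suc N′) (suc i) + m)  ≡⟨ ∂-cascade i (suc N′) m m<B ⟩
  predBinom (suc N′) i + ∂ i m            ≡⟨ cong (_+ ∂ i m) (predBinom-suc N′ i) ⟩
  binom N′ i + ∂ i m                      ≤⟨ +-monoʳ-≤ (binom N′ i) (∂≤id i m) ⟩
  binom N′ i + m                          <⟨ +-monoˡ-< m (m<m+n (binom N′ i) (binom-pos N′ (suc i) i<N′)) ⟩
  binom (suc N′) (suc i) + m              ∎
  where open ≤-Reasoning
...     | inj₂ refl = begin-strict
  ∂ (suc i) (binom (suc i) (suc i) + m)   ≡⟨ ∂-cascade i (suc i) m m<B ⟩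
  predBinom (suc i) i + ∂ i m             ≡⟨ cong (_+ ∂ i m) (trans (predBinom-suc i i) (binom-diag i)) ⟩
  1 + ∂ i m                               <⟨ s≤s (∂<id i m i<m) ⟩
  1 + m                                   ≡⟨ cong (_+ m) (sym (binom-diag (suc i))) ⟩
  binom (suc i) (suc i) + m               ∎
  where
  open ≤-Reasoning
  i<m : i < m
  i<m = ≤-pred (subst (suc i <_) (cong (_+ m) (binom-diag (suc i))) i<y)

-- With z = binom M k - (w + s), duality turns both sides into
-- ∂ (M-k) of sums with z, and the claim becomes subadditivity of ∂ (M-k).
∂-increment : ∀ k M w s → 1 ≤ M → k ≤ M → w + s ≤ binom M k →
              ∂ k w + s ≤ ∂ k (w + s) + ∂ (M ∸ k) s
∂-increment k M w s 1≤M k≤M w+s≤Q = +-cancelʳ-≤ z _ _ (begin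
  ∂ k w + s + z                     ≡⟨ +-assoc (∂ k w) s z ⟩
  ∂ k w + (s + z)                   ≡⟨ dual w (s + z) (trans (sym (+-assoc w s z)) w+s+z≡Q) ⟩
  ∂Q + ∂ J (s + z)                  ≤⟨ +-monoʳ-≤ ∂Q (∂-subadditive J s z) ⟩
  ∂Q + (∂ J s + ∂ J z)              ≡⟨ cong (∂Q +_) (+-comm (∂ J s) (∂ J z)) ⟩
  ∂Q + (∂ J z + ∂ J s)              ≡⟨ sym (+-assoc ∂Q (∂ J z) (∂ J s)) ⟩
  ∂Q + ∂ J z + ∂ J s                ≡⟨ cong (_+ ∂ J s) (sym (dual (w + s) z w+s+z≡Q)) ⟩
  ∂ k (w + s) + z + ∂ J s           ≡⟨ +-right-comm (∂ k (w + s)) z (∂ J s) ⟩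
  ∂ k (w + s) + ∂ J s + z           ∎)
  where
  open ≤-Reasoning
  J = M ∸ k
  ∂Q = predBinom M J
  z = binom M k ∸ (w + s)
  w+s+z≡Q : w + s + z ≡ binom M k
  w+s+z≡Q = m+[n∸m]≡n w+s≤Q
  dual : ∀ x y → x + y ≡ binom M k → ∂ k x + y ≡ ∂Q + ∂ J y
  dual = ∂-complement′ k M 1≤M k≤M

-- Strictness from the complete level binom M (k+1) with M ≤ k + J: the defect
-- ∂ (M-k-1) J in ∂-increment is smaller than J.
∂-strict-below-binom : ∀ k J w M → suc k ≤ M → M ≤ k + J → w + J ≤ binom M (suc k) →
                       ∂ (suc k) w < ∂ (suc k) (w + J)
∂-strict-below-binom k J w M k<M M≤k+J w+J≤Q = +-cancelʳ-< J _ _ (begin-strict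
  ∂ (suc k) w + J                         ≤⟨ ∂-increment (suc k) M w J (≤-trans (s≤s z≤n) k<M) k<M w+J≤Q ⟩
  ∂ (suc k) (w + J) + ∂ (M ∸ suc k) J     <⟨ +-monoʳ-< (∂ (suc k) (w + J)) (∂<id (M ∸ suc k) J defect<J) ⟩
  ∂ (suc k) (w + J) + J                   ∎)
  where
  open ≤-Reasoning
  defect<J : M ∸ suc k < J
  defect<J = +-cancelˡ-< (suc k) (M ∸ suc k) J (subst (_< suc k + J) (sym (m+[n∸m]≡n k<M)) (s≤s M≤k+J))

-- If the top block of w + J is binom M (k+2) and the nonempty remainder m + 1 is
-- shorter than J, then w lies below the block, whose shadow binom (M-1) (k+1) is
-- already smaller than the cascade value of w + J.
∂-strict-short-remainder : ∀ k M w J m → suc m < J → suc m < binom M (suc k) →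
  w + J ≡ binom M (suc (suc k)) + suc m → ∂ (suc (suc k)) w < ∂ (suc (suc k)) (w + J)
∂-strict-short-remainder k M w J m m<J m<B split = begin-strict
  ∂ K w                              ≤⟨ ∂-mono K (<⇒≤ w<Q) ⟩
  ∂ K (binom M K)                    ≡⟨ ∂-binom′ M k′ ⟩
  predBinom M k′                     ≡⟨ sym (+-identityʳ _) ⟩
  predBinom M k′ + 0                 <⟨ +-monoʳ-< (predBinom M k′) (∂-pos k m) ⟩
  predBinom M k′ + ∂ k′ (suc m)      ≡⟨ sym (∂-cascade k′ M (suc m) m<B) ⟩
  ∂ K (binom M K + suc m)            ≡⟨ cong (∂ K) (sym split) ⟩
  ∂ K (w + J)                        ∎
  where
  open ≤-Reasoning
  k′ = suc k
  K  = suc k′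
  w<Q : w < binom M K
  w<Q = +-cancelʳ-< J w (binom M K) (subst (_< binom M K + J) (sym split) (+-monoʳ-< (binom M K) m<J))

mutual
  -- Take the top decomposition w + J = binom N (k+1) + m; then N ≤ k + J, and
  -- for N < k + J the complete level binom (N+1) (k+1) gives strictness.
  ∂-strict-mono : ∀ k J w → 1 ≤ J → w + J < binom (suc k + J) (suc k) → ∂ (suc k) w < ∂ (suc k) (w + J)
  ∂-strict-mono k J w 1≤J bound with topDecomposition k (w + J)
  ... | top N m k≤N m<B split with m≤n⇒m<n∨m≡n N≤k+J
    where
    N≤k+J : N ≤ k + J
    N≤k+J = ≮⇒≥ λ k+J<N → <⇒≱ bound
      (≤-trans (binom-mono (suc k) k+J<N) (subst (binom N (suc k) ≤_) (sym split) (m≤m+n _ m)))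
  ... | inj₁ N<k+J = ∂-strict-below-binom k J w (suc N) (s≤s k≤N) N<k+J (<⇒≤ (begin-strict
    w + J                              ≡⟨ split ⟩
    binom N (suc k) + m                <⟨ +-monoʳ-< (binom N (suc k)) m<B ⟩
    binom N (suc k) + binom N k        ≡⟨ +-comm (binom N (suc k)) (binom N k) ⟩
    binom (suc N) (suc k)              ∎))
    where open ≤-Reasoning
  ... | inj₂ refl = ∂-strict-mono-top k J w m 1≤J m<B split

  -- For m = 0
  -- the complete level itself gives strictness; for J ≤ m both w and w + J share the
  -- top block and the claim descends one level to m - J and m; for m < J see above.
  ∂-strict-mono-top : ∀ k J w m → 1 ≤ J → m < binom (k + J) k →
    w + J ≡ binom (k + J) (suc k) + m → ∂ (suc k) w < ∂ (suc k) (w + J)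
  ∂-strict-mono-top k J w zero 1≤J _ split =
    ∂-strict-below-binom k J w (k + J) (subst (_≤ k + J) (+-comm k 1) (+-monoʳ-≤ k 1≤J)) ≤-refl
                         (≤-reflexive (trans split (+-identityʳ _)))
  ∂-strict-mono-top zero      J w (suc m) 1≤J (s≤s ()) split
  ∂-strict-mono-top (suc k′) J w (suc m) 1≤J m<B split with J ≤? suc m
  ... | yes J≤m = begin-strict
    ∂ K w                              ≡⟨ cong (∂ K) w≡ ⟩
    ∂ K (binom M K + w')               ≡⟨ ∂-cascade k M w' w'<B ⟩
    predBinom M k + ∂ k w'             <⟨ +-monoʳ-< (predBinom M k) (∂-strict-mono k′ J w' 1≤J (subst (_< binom M k) (sym w'+J≡m) m<B)) ⟩
    predBinom M k + ∂ k (w' + J)       ≡⟨ cong (λ t → predBinom M k + ∂ k t) w'+J≡m ⟩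
    predBinom M k + ∂ k (suc m)        ≡⟨ sym (∂-cascade k M (suc m) m<B) ⟩
    ∂ K (binom M K + suc m)            ≡⟨ cong (∂ K) (sym split) ⟩
    ∂ K (w + J)                        ∎
    where
    open ≤-Reasoning
    k = suc k′
    K = suc k
    M = k + J
    w' = suc m ∸ J
    w'+J≡m : w' + J ≡ suc m
    w'+J≡m = m∸n+n≡m J≤m
    w'<B : w' < binom M k
    w'<B = ≤-<-trans (≤-trans (m≤m+n w' J) (≤-reflexive w'+J≡m)) m<B
    w≡ : w ≡ binom M K + w'
    w≡ = +-cancelʳ-≡ J w (binom M K + w')
           (trans split (trans (cong (binom M K +_) (sym w'+J≡m)) (sym (+-assoc (binom M K) w' J))))
  ... | no J≰m = ∂-strict-short-remainder k′ (suc k′ + J) w J m (≰⇒> J≰m) m<B split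

-- Strictness at a complete level n = binom (M+1) K, K = k + 2, for 1 ≤ a < ∂ K n.
-- Removing at most J = M - k - 1 elements from n leaves the shadow ∂ K n = binom M (k+1).
module _ (k M : ℕ) (k<M : suc k ≤ M) where
  private
    K = suc (suc k)
    n = binom (suc M) K
    J = M ∸ suc k

  k+J≡M : suc k + J ≡ M
  k+J≡M = m+[n∸m]≡n k<M

  ∂n≡ : ∂ K n ≡ binom M (suc k)
  ∂n≡ = ∂-binom M (suc k)

  a≤n : ∀ {a} → a < ∂ K n → a ≤ n
  a≤n {a} a<∂n = ≤-trans (<⇒≤ (subst (a <_) ∂n≡ a<∂n)) (m≤m+n (binom M (suc k)) _)

  ∂-remove : ∀ s → s ≤ J → s ≤ n → ∂ K (n ∸ s) ≡ ∂ K n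
  ∂-remove s s≤J s≤n = trans (∂-near-binom (suc k) (suc M) s (n ∸ s) (m∸n+n≡m s≤n) s+K≤)
                         (trans (predBinom-suc M (suc k)) (sym ∂n≡))
    where
    s+K≤ : s + K ≤ suc M
    s+K≤ = subst (_≤ suc M) (sym (+-suc s (suc k)))
             (s≤s (subst (s + suc k ≤_) (trans (+-comm J (suc k)) k+J≡M) (+-monoˡ-≤ (suc k) s≤J)))

  -- J ≥ 1 as soon as some a > J lies below ∂ K n = binom M (k+1): for J = 0 the
  -- latter is binom (k+1) (k+1) = 1.
  J-positive : ∀ {a} → J < a → a < binom M (suc k) → 1 ≤ J
  J-positive {a} J<a a<B = n≢0⇒n>0 λ J≡0 → <⇒≱ a<B (begin
    binom M (suc k)          ≡⟨ cong (λ t → binom t (suc k)) (trans (sym k+J≡M) (trans (cong (suc k +_) J≡0) (+-identityʳ (suc k)))) ⟩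
    binom (suc k) (suc k)    ≡⟨ binom-diag (suc k) ⟩
    1                        ≤⟨ subst (_< a) J≡0 J<a ⟩
    a                        ∎)
    where open ≤-Reasoning

  -- Few elements removed (a ≤ J): the shadow of n - a is that of n, and ∂ (k+1) a ≥ 1.
  strict-few-removed : ∀ a → 1 ≤ a → a ≤ J → a ≤ n → ∂ K n < ∂ (suc k) a + ∂ K (n ∸ a)
  strict-few-removed (suc a) _ a≤J a≤n = begin-strict
    ∂ K n                                  <⟨ m<n+m (∂ K n) (∂-pos k a) ⟩
    ∂ (suc k) (suc a) + ∂ K n              ≡⟨ cong (∂ (suc k) (suc a) +_) (sym (∂-remove (suc a) a≤J a≤n)) ⟩
    ∂ (suc k) (suc a) + ∂ K (n ∸ suc a)    ∎
    where open ≤-Reasoning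

  -- Many elements removed (J < a): write a = w + J.  Removing J elements keeps the
  -- shadow, the shadow inequality applies to w and n - a, and ∂ (k+1) w < ∂ (k+1) a.
  strict-many-removed : ∀ a → J < a → a < binom M (suc k) → a ≤ n → ∂ K n < ∂ (suc k) a + ∂ K (n ∸ a)
  strict-many-removed a J<a a<B a≤n = begin-strict
    ∂ K n                            ≡⟨ sym (∂-remove J ≤-refl J≤n) ⟩
    ∂ K (n ∸ J)                      ≡⟨ cong (∂ K) (sym w+rest≡) ⟩
    ∂ K (w + (n ∸ a))                ≤⟨ shadow-inequality (suc k) w (n ∸ a) w<∂ ⟩
    ∂ (suc k) w + ∂ K (n ∸ a)        <⟨ +-monoˡ-< (∂ K (n ∸ a)) ∂w<∂a ⟩
    ∂ (suc k) a + ∂ K (n ∸ a)        ∎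
    where
    open ≤-Reasoning
    w = a ∸ J
    w+J≡a : w + J ≡ a
    w+J≡a = m∸n+n≡m (<⇒≤ J<a)
    J≤n : J ≤ n
    J≤n = ≤-trans (<⇒≤ J<a) a≤n
    w+rest≡ : w + (n ∸ a) ≡ n ∸ J
    w+rest≡ = +-cancelʳ-≡ J _ _ (begin-equality
      w + (n ∸ a) + J                ≡⟨ +-assoc w (n ∸ a) J ⟩
      w + (n ∸ a + J)                ≡⟨ cong (w +_) (+-comm (n ∸ a) J) ⟩
      w + (J + (n ∸ a))              ≡⟨ sym (+-assoc w J (n ∸ a)) ⟩
      w + J + (n ∸ a)                ≡⟨ cong (_+ (n ∸ a)) w+J≡a ⟩
      a + (n ∸ a)                    ≡⟨ m+[n∸m]≡n a≤n ⟩
      n                              ≡⟨ sym (m∸n+n≡m J≤n) ⟩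
      n ∸ J + J                      ∎)
    w<∂ : w < ∂ K (w + (n ∸ a))
    w<∂ = begin-strict
      w                              ≤⟨ m∸n≤m a J ⟩
      a                              <⟨ a<B ⟩
      binom M (suc k)                ≡⟨ sym ∂n≡ ⟩
      ∂ K n                          ≡⟨ sym (∂-remove J ≤-refl J≤n) ⟩
      ∂ K (n ∸ J)                    ≡⟨ cong (∂ K) (sym w+rest≡) ⟩
      ∂ K (w + (n ∸ a))              ∎
    ∂w<∂a : ∂ (suc k) w < ∂ (suc k) a
    ∂w<∂a = subst (λ t → ∂ (suc k) w < ∂ (suc k) t) w+J≡a
              (∂-strict-mono k J w (J-positive J<a a<B) (subst₂ (λ s t → s < binom t (suc k)) (sym w+J≡a) (sym k+J≡M) a<B))

  strict-at-binom : ∀ a → 1 ≤ a → a < ∂ K n → ∂ K n < ∂ (suc k) a + ∂ K (n ∸ a)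
  strict-at-binom a 1≤a a<∂n with ≤-<-connex a J
  ... | inj₁ a≤J = strict-few-removed a 1≤a a≤J (a≤n a<∂n)
  ... | inj₂ J<a = strict-many-removed a J<a (subst (a <_) ∂n≡ a<∂n) (a≤n a<∂n)

inequality : ∀ k a n → a ≤ n → a < ∂ (suc k) n → ∂ (suc k) n ≤ ∂ k a + ∂ (suc k) (n ∸ a)
inequality k a n a≤n a<∂n =
  subst (λ t → ∂ (suc k) t ≤ ∂ k a + ∂ (suc k) (n ∸ a)) a+[n∸a]≡n
        (shadow-inequality k a (n ∸ a) (subst (λ t → a < ∂ (suc k) t) (sym a+[n∸a]≡n) a<∂n))
  where
  a+[n∸a]≡n : a + (n ∸ a) ≡ n
  a+[n∸a]≡n = m+[n∸m]≡n a≤n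

equality-only-at-zero : ∀ k a n → 1 ≤ k → a < ∂ (suc k) n → (N : ℕ) → suc k ≤ N → n ≡ N C suc k →
                        ∂ k a + ∂ (suc k) (n ∸ a) ≡ ∂ (suc k) n → a ≡ 0
equality-only-at-zero k       zero    n _  _    _       _         _  _  = refl
equality-only-at-zero (suc k) (suc a) n _  a<∂n (suc M) (s≤s k<M) n≡ eq =
  ⊥-elim (<-irrefl (sym eq′) (strict-at-binom k M k<M (suc a) (s≤s z≤n) (subst (λ t → suc a < ∂ (suc (suc k)) t) n≡B a<∂n)))
  where
  n≡B : n ≡ binom (suc M) (suc (suc k))
  n≡B = trans n≡ (sym (binom≡C (suc M) (suc (suc k))))
  eq′ : ∂ (suc k) (suc a) + ∂ (suc (suc k)) (binom (suc M) (suc (suc k)) ∸ suc a) ≡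
        ∂ (suc (suc k)) (binom (suc M) (suc (suc k)))
  eq′ = subst (λ t → ∂ (suc k) (suc a) + ∂ (suc (suc k)) (t ∸ suc a) ≡ ∂ (suc (suc k)) t) n≡B eq

theorem1 : (k a n : ℕ) → 1 ≤ k → a ≤ n → a < ∂ (suc k) n →
    (∂ k a + ∂ (suc k) (n ∸ a) ≥ ∂ (suc k) n)
    × ((N : ℕ) → suc k ≤ N → n ≡ N C suc k →
    ∂ k a + ∂ (suc k) (n ∸ a) ≡ ∂ (suc k) n → a ≡ 0)
theorem1 k a n 1≤k a≤n a<∂n = inequality k a n a≤n a<∂n , equality-only-at-zero k a n 1≤k a<∂n
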